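{- Let $\Sigma$ be a finite alphabet with $n$ letters, let $I$ be any (well-ordered) index set, finite, infinite or uncountable, and let $\Delta\subseteq\Sigma^I$ be any nonempty dictionary. In Wordle with dictionary $\Delta$, the codebreaker has a strategy that wins within $n$ guesses (i.e., for every codeword $w\in\Delta$, one of the guesses $s_0,\dots,s_{n-1}$ equals $w$). Furthermore, there is such a strategy in which every guess is consistent with all the feedback (green, yellow and gray) received for previous guesses, and there is also such a strategy that uses only the green feedback information.
   Context: Wordle with alphabet $\Sigma$, a well-ordered set $I$ of positions and a nonempty dictionary $\Delta\subseteq\Sigma^I$: a hidden codeword $w\in\Delta$ is fixed; the codebreaker successively places guesswords $s_0,s_1,\dots\in\Delta$. After each guess $s$ she receives feedback: position $i$ is green if $s(i)=w(i)$; among the non-green positions of $s$ carrying a letter $a$, the first $k$ of them (in the order of $I$) are yellow, where $k$ is the number of non-green positions $j$ with $w(j)=a$; all other positions are gray. A strategy tells the codebreaker which word to guess next as a function of the feedback received for earlier guesses; it is winning if for every codeword the strategy at some stage places that codeword as the guess. A guess is consistent with previous feedback if, were it the codeword, it would have produced the same feedback to all previous guesses. -}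

module Defs where

open import Level using (0ℓ)
open import Data.Nat using (ℕ; _≤_; _<_)
open import Data.Fin using (Fin)
open import Data.Bool using (Bool; true; false)
open import Data.List using (List; []; _∷_; length; map; _++_)
open import Data.Product using (Σ; _×_; ∃; ∃₂; proj₁)
open import Data.Unit using (⊤)
open import Relation.Nullary using (¬_)
open import Relation.Binary.Core using (Rel)
open import Relation.Binary.PropositionalEquality using (_≡_; _≢_)

data Colour : Set where
  green yellow gray : Colour

isGreen : Colour → Bool
isGreen green  = true
isGreen yellow = false
isGreen gray   = false

module Wordle (n : ℕ) (I : Set) (_≺_ : Rel I 0ℓ) (Δ : (I → Fin n) → Set) where

  Word : Set
  Word = I → Fin n

  SameWord : Word → Word → Set
  SameWord u v = ∀ i → u i ≡ v i

  -- Cardinal comparison of subsets of I (given by predicates):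
  -- P ≼ Q : there is an injection from {j | P j} into {j | Q j}.
  _≼_ : (I → Set) → (I → Set) → Set
  P ≼ Q = Σ ((j : I) → P j → I) λ f →
            (∀ j p → Q (f j p)) ×
            (∀ j j′ p p′ → f j p ≡ f j′ p′ → j ≡ j′)

  _≺ᶜ_ : (I → Set) → (I → Set) → Set
  P ≺ᶜ Q = (P ≼ Q) × ¬ (Q ≼ P)

  EarlierSame : Word → Word → I → I → Set
  EarlierSame w s i j = (j ≺ i) × (s j ≢ w j) × (s j ≡ s i)

  CodeSame : Word → Word → I → I → Set
  CodeSame w s i j = (s j ≢ w j) × (w j ≡ s i)

  -- Position i is yellow: non-green, and it is among the first k
  -- non-green positions of s carrying its letter, k = number of
  -- non-green positions of w carrying that letter; i.e. fewer than k
  -- such positions of s precede i.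
  Yellow : Word → Word → I → Set
  Yellow w s i = (s i ≢ w i) × (EarlierSame w s i ≺ᶜ CodeSame w s i)

  data ColourOf (w s : Word) (i : I) : Colour → Set where
    isG : s i ≡ w i → ColourOf w s i green
    isY : Yellow w s i → ColourOf w s i yellow
    isR : s i ≢ w i → ¬ Yellow w s i → ColourOf w s i gray

  Feedback : Set
  Feedback = I → Colour

  IsFeedback : Word → Word → Feedback → Set
  IsFeedback w s f = ∀ i → ColourOf w s i (f i)

  -- Histories of feedback, MOST RECENT FIRST: the history after the
  -- guesses s₀,…,s_{k-1} is f_{k-1} ∷ … ∷ f₀ ∷ [].
  History : Set
  History = List Feedback

  Strategy : Set
  Strategy = History → Σ Word Δ

  guess : Strategy → History → Word
  guess σ h = proj₁ (σ h)

  -- Word g is consistent with history h played by σ: were g the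
  -- codeword, it would have produced every feedback in h.
  -- (A history h arises in play against codeword w iff Consistent σ w h.)
  Consistent : Strategy → Word → History → Set
  Consistent σ g []      = ⊤
  Consistent σ g (f ∷ h) = IsFeedback g (guess σ h) f × Consistent σ g h

  WinsWithin : ℕ → Strategy → Set
  WinsWithin k σ = ∀ (w : Word) → Δ w → ∀ (h : History) → Consistent σ w h →
    k ≤ length h →
    ∃₂ λ h₀ h′ → (h ≡ h₀ ++ h′) × (length h′ < k) × SameWord (guess σ h′) w

  AlwaysConsistent : Strategy → Set
  AlwaysConsistent σ = ∀ (w : Word) → Δ w → ∀ (h : History) →
    Consistent σ w h → Consistent σ (guess σ h) h

  GreenMask : Set
  GreenMask = I → Bool

  greenMask : Feedback → GreenMask
  greenMask f i = isGreen (f i)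

  GreenStrategy : Set
  GreenStrategy = List GreenMask → Σ Word Δ

  fromGreen : GreenStrategy → Strategy
  fromGreen τ h = τ (map greenMask h)

-- If every guess shows the same green positions as the codeword w on all
-- earlier guesses, then at a position i where the current guess is still
-- wrong no earlier guess was right, and no two guesses share their letter
-- at i (sharing it with a later guess c would make the earlier one green
-- against c, hence against w).  So the letters at i of the guesses made so
-- far are pairwise distinct and avoid w i: there are at most n - 1 of them,
-- and the n-th guess is w.  Both the strategy playing a dictionary word
-- consistent with all feedback and the one playing a word consistent with
-- the green feedback alone have this property; such words exist because w
-- itself is one, and excluded middle lets the codebreaker choose one.
module Submission where

open import Defs
open import Level using (0ℓ)
open import Data.Nat using (ℕ; _≤_)
open import Data.Fin using (Fin)
open import Data.Product using (_×_; ∃)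
open import Relation.Binary.Core using (Rel)
open import Relation.Binary.Structures using (IsStrictTotalOrder)
open import Relation.Binary.PropositionalEquality using (_≡_)
open import Induction.WellFounded using (WellFounded)
open import Axiom.ExcludedMiddle using (ExcludedMiddle)

open import Data.Nat using (zero; suc; _∸_; s≤s)
open import Data.Nat.Properties using (1+n≰n; m∸[m∸n]≡n; ≤-reflexive; <⇒≤)
open import Data.Fin using (zero; suc)
open import Data.Fin.Properties using (punchOut-injective; injective⇒≤; _≟_)
open import Data.Bool using (true)
open import Data.List using (List; []; _∷_; length; map; lookup; take; drop)
open import Data.List.Properties using (length-map; length-drop; take++drop≡id)
open import Data.List.Membership.Propositional.Properties using (∈-lookup)
open import Data.List.Relation.Unary.All as All using (All; []; _∷_)
open import Data.List.Relation.Unary.All.Properties using (map⁺)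
open import Data.List.Relation.Unary.AllPairs using (AllPairs; []; _∷_)
open import Data.List.Relation.Unary.Unique.Propositional using (Unique)
open import Data.Product using (Σ; _,_; proj₁)
open import Data.Unit using (⊤; tt)
open import Data.Empty using (⊥-elim)
open import Function using (_∘_; const)
open import Function.Bundles using (_⇔_; mk⇔; Equivalence)
open import Function.Construct.Composition using (_⇔-∘_)
open import Function.Construct.Symmetry using (⇔-sym)
open import Function.Construct.Identity using (⇔-id)
open import Data.Product.Function.NonDependent.Propositional using (_×-⇔_)
open import Function.Definitions using (Injective)
open import Relation.Nullary using (yes; no; contradiction)
open import Relation.Binary.PropositionalEquality using (refl; sym; trans; cong; subst; _≢_; ≢-sym)

open Equivalence using (to; from)

lookup-injective : ∀ {A : Set} {xs : List A} → Unique xs → Injective _≡_ _≡_ (lookup xs)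
lookup-injective (_ ∷ _)    {zero}  {zero}  _  = refl
lookup-injective (x∉xs ∷ _) {zero}  {suc j} eq = contradiction eq (All.lookup x∉xs (∈-lookup j))
lookup-injective (x∉xs ∷ _) {suc i} {zero}  eq = contradiction (sym eq) (All.lookup x∉xs (∈-lookup i))
lookup-injective (_ ∷ xs!)  {suc i} {suc j} eq = cong suc (lookup-injective xs! eq)

unique-avoiding-length : ∀ {m} {a : Fin (suc m)} {xs : List (Fin (suc m))} →
                         Unique xs → All (_≢ a) xs → length xs ≤ m
unique-avoiding-length {a = a} {xs} xs! xs≢a =
  injective⇒≤ λ eq → lookup-injective xs! (punchOut-injective (a≢ _) (a≢ _) eq)
  where
  a≢ : ∀ j → a ≢ lookup xs j
  a≢ j = ≢-sym (All.lookup xs≢a (∈-lookup j))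

module _ {I A : Set} where

  GreenAgree : (I → A) → (I → A) → (I → A) → Set
  GreenAgree w c s = ∀ i → (s i ≡ w i) ⇔ (s i ≡ c i)

  mismatch-propagates : ∀ {w c i ss} → All (GreenAgree w c) ss → c i ≢ w i →
                        All (λ s → s i ≢ w i) ss
  mismatch-propagates {i = i} agree c≢w =
    All.map (λ s≈ s≡w → c≢w (trans (sym (to (s≈ i) s≡w)) s≡w)) agree

  mismatched-letters-unique : ∀ {w i ss} → AllPairs (GreenAgree w) ss →
                              All (λ s → s i ≢ w i) ss → Unique (map (λ s → s i) ss)
  mismatched-letters-unique [] [] = []
  mismatched-letters-unique {i = i} (agree ∷ chain) (_ ∷ wrong) =
    map⁺ (All.zipWith (λ (s≈ , s≢w) c≡s → s≢w (from (s≈ i) (sym c≡s))) (agree , wrong))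
    ∷ mismatched-letters-unique chain wrong

green-chain-solves : ∀ {I m} {w c : I → Fin (suc m)} {ss} →
                     AllPairs (GreenAgree w) (c ∷ ss) → length ss ≡ m → ∀ i → c i ≡ w i
green-chain-solves {m = m} {w} {c} {ss} chain@(agree ∷ _) len i with c i ≟ w i
... | yes c≡w = c≡w
... | no c≢w = contradiction (subst (_≤ m) letters-length bound) 1+n≰n
  where
  wrong : All (λ s → s i ≢ w i) (c ∷ ss)
  wrong = c≢w ∷ mismatch-propagates agree c≢w

  bound : length (map (λ s → s i) (c ∷ ss)) ≤ m
  bound = unique-avoiding-length (mismatched-letters-unique chain wrong) (map⁺ wrong)

  letters-length : length (map (λ s → s i) (c ∷ ss)) ≡ suc m
  letters-length = trans (length-map _ (c ∷ ss)) (cong suc len)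

module Play (m : ℕ) (I : Set) (_≺_ : Rel I 0ℓ) (Δ : (I → Fin (suc m)) → Set) where
  open Wordle (suc m) I _≺_ Δ

  GreenReads : GreenMask → Word → Word → Set
  GreenReads g s w = ∀ i → (g i ≡ true) ⇔ (s i ≡ w i)

  colour-reads-green : ∀ {w s i col} → ColourOf w s i col → (isGreen col ≡ true) ⇔ (s i ≡ w i)
  colour-reads-green (isG s≡w)       = mk⇔ (const s≡w) (const refl)
  colour-reads-green (isY (s≢w , _)) = mk⇔ (λ ()) (⊥-elim ∘ s≢w)
  colour-reads-green (isR s≢w _)     = mk⇔ (λ ()) (⊥-elim ∘ s≢w)

  greenReads-agree : ∀ {g s w c} → GreenReads g s w → GreenReads g s c → GreenAgree w c s
  greenReads-agree w-reads c-reads i = c-reads i ⇔-∘ ⇔-sym (w-reads i)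

  previous : Strategy → History → List Word
  previous σ []      = []
  previous σ (f ∷ h) = guess σ h ∷ previous σ h

  length-previous : ∀ σ h → length (previous σ h) ≡ length h
  length-previous σ []      = refl
  length-previous σ (f ∷ h) = cong suc (length-previous σ h)

  GreensMatch : Strategy → Word → History → Set
  GreensMatch σ w []      = ⊤
  GreensMatch σ w (f ∷ h) = GreenReads (greenMask f) (guess σ h) w × GreensMatch σ w h

  consistent⇒greensMatch : ∀ {σ w} h → Consistent σ w h → GreensMatch σ w h
  consistent⇒greensMatch []      _              = tt
  consistent⇒greensMatch (f ∷ h) (feedback , c) =
    (colour-reads-green ∘ feedback) , consistent⇒greensMatch h c

  greensMatch-agree : ∀ {σ w c} h → GreensMatch σ w h → GreensMatch σ c h →
                      All (GreenAgree w c) (previous σ h)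
  greensMatch-agree []      _            _            = []
  greensMatch-agree (f ∷ h) (w-reads , w-match) (c-reads , c-match) =
    greenReads-agree w-reads c-reads ∷ greensMatch-agree h w-match c-match

  GreenConsistent : Strategy → Set
  GreenConsistent σ = ∀ w → Δ w → ∀ h → Consistent σ w h → GreensMatch σ (guess σ h) h

  green-chain : ∀ {σ w} → GreenConsistent σ → Δ w → ∀ h → Consistent σ w h →
                AllPairs (GreenAgree w) (guess σ h ∷ previous σ h)
  green-chain gc w∈Δ []      _            = [] ∷ []
  green-chain gc w∈Δ (f ∷ h) c@(_ , c′) =
    greensMatch-agree (f ∷ h) (consistent⇒greensMatch (f ∷ h) c) (gc _ w∈Δ (f ∷ h) c)
    ∷ green-chain gc w∈Δ h c′

  consistent-drop : ∀ {σ w} k h → Consistent σ w h → Consistent σ w (drop k h)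
  consistent-drop zero    h       c       = c
  consistent-drop (suc k) []      c       = c
  consistent-drop (suc k) (f ∷ h) (_ , c) = consistent-drop k h c

  wins-if-solved-after : ∀ {σ} →
    (∀ w → Δ w → ∀ h → Consistent σ w h → length h ≡ m → SameWord (guess σ h) w) →
    WinsWithin (suc m) σ
  wins-if-solved-after solved w w∈Δ h c m<h =
    take k h , drop k h , sym (take++drop≡id k h) , s≤s (≤-reflexive length-suffix) ,
    solved w w∈Δ (drop k h) (consistent-drop k h c) length-suffix
    where
    k : ℕ
    k = length h ∸ m
    length-suffix : length (drop k h) ≡ m
    length-suffix = trans (length-drop k h) (m∸[m∸n]≡n (<⇒≤ m<h))

  greenConsistent⇒wins : ∀ {σ} → GreenConsistent σ → WinsWithin (suc m) σ
  greenConsistent⇒wins {σ} gc = wins-if-solved-after λ w w∈Δ h c len →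
    green-chain-solves (green-chain gc w∈Δ h c) (trans (length-previous σ h) len)

  module Greedy (lem : ExcludedMiddle 0ℓ) (w₀ : Word) (w₀∈Δ : Δ w₀) where

    choose : (Word → Set) → Σ Word Δ
    choose P with lem {∃ λ c → Δ c × P c}
    ... | yes (c , c∈Δ , _) = c , c∈Δ
    ... | no _              = w₀ , w₀∈Δ

    choose-spec : ∀ (P : Word → Set) → (∃ λ c → Δ c × P c) → P (proj₁ (choose P))
    choose-spec P witness with lem {∃ λ c → Δ c × P c}
    ... | yes (_ , _ , Pc) = Pc
    ... | no ¬witness      = contradiction witness ¬witness

    -- Fits c s o: had c been the codeword, guess s would have been answered by observation o.
    module Fitting {O : Set} (Fits : Word → Word → O → Set) where
      mutual
        greedy : List O → Σ Word Δ
        greedy os = choose λ c → FitsAll c os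

        FitsAll : Word → List O → Set
        FitsAll c []       = ⊤
        FitsAll c (o ∷ os) = Fits c (proj₁ (greedy os)) o × FitsAll c os

      greedy-fits : ∀ {w} os → Δ w → FitsAll w os → FitsAll (proj₁ (greedy os)) os
      greedy-fits {w} os w∈Δ w-fits = choose-spec (λ c → FitsAll c os) (w , w∈Δ , w-fits)

    module Full  = Fitting IsFeedback
    module Green = Fitting (λ c s g → GreenReads g s c)

    consistent-strategy : Strategy
    consistent-strategy = Full.greedy

    green-strategy : GreenStrategy
    green-strategy = Green.greedy

    consistent⇔fitsAll : ∀ {c} h → Consistent consistent-strategy c h ⇔ Full.FitsAll c h
    consistent⇔fitsAll []      = ⇔-id _
    consistent⇔fitsAll (f ∷ h) = ⇔-id _ ×-⇔ consistent⇔fitsAll h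

    greensMatch⇔fitsAll : ∀ {c} h →
      GreensMatch (fromGreen green-strategy) c h ⇔ Green.FitsAll c (map greenMask h)
    greensMatch⇔fitsAll []      = ⇔-id _
    greensMatch⇔fitsAll (f ∷ h) = ⇔-id _ ×-⇔ greensMatch⇔fitsAll h

    consistent-strategy-consistent : AlwaysConsistent consistent-strategy
    consistent-strategy-consistent w w∈Δ h c =
      from (consistent⇔fitsAll h) (Full.greedy-fits h w∈Δ (to (consistent⇔fitsAll h) c))

    consistent-strategy-greenConsistent : GreenConsistent consistent-strategy
    consistent-strategy-greenConsistent w w∈Δ h c =
      consistent⇒greensMatch h (consistent-strategy-consistent w w∈Δ h c)

    green-strategy-greenConsistent : GreenConsistent (fromGreen green-strategy)
    green-strategy-greenConsistent w w∈Δ h c =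
      from (greensMatch⇔fitsAll h)
           (Green.greedy-fits (map greenMask h) w∈Δ
                              (to (greensMatch⇔fitsAll h) (consistent⇒greensMatch h c)))

mainTheorem2 : ExcludedMiddle 0ℓ →
    (n : ℕ) → 1 ≤ n →
    (I : Set) (_≺_ : Rel I 0ℓ) → IsStrictTotalOrder _≡_ _≺_ → WellFounded _≺_ →
    (Δ : (I → Fin n) → Set) → ∃ Δ →
    let open Wordle n I _≺_ Δ in
    (∃ λ σ → WinsWithin n σ) ×
    (∃ λ σ → WinsWithin n σ × AlwaysConsistent σ) ×
    (∃ λ τ → WinsWithin n (fromGreen τ))
mainTheorem2 lem (suc m) _ I _≺_ _ _ Δ (w₀ , w₀∈Δ) =
  (consistent-strategy , greenConsistent⇒wins consistent-strategy-greenConsistent) ,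
  (consistent-strategy , greenConsistent⇒wins consistent-strategy-greenConsistent ,
                         consistent-strategy-consistent) ,
  (green-strategy , greenConsistent⇒wins green-strategy-greenConsistent)
  where
  open Play m I _≺_ Δ
  open Greedy lem w₀ w₀∈Δ
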